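{- Let $r=r_1r_2\cdots r_n$ be the row reading word of a standard tableau $P$. (1) If one performs a $K_1^-$ move on $r$, the move is a $K_B$ move. (2) Suppose one can perform a $K_1^+$ move $yxz\mapsto yzx$ (with $x<y<z$) on $r$. If $r_1\neq y$, then $r=r_1\cdots r_\ell\,y\,x\,z\cdots r_n$ with $r_1>r_2>\cdots>r_\ell>y>x$; and the tableau $P$ has the following form: the entry $y$ is alone in its row, the row immediately above the row of $y$ begins with the entries $x,z$ (possibly followed by further entries), and the rows below the row of $y$ are the single entries $r_\ell,\dots,r_1$ (from top to bottom). (3) If one performs a $K_1^+$ move on $r$, the move is not a $K_B$ move.
   Context: Tableaux are in English notation; the row reading word of a tableau is the concatenation of its rows from bottom to top, each read left to right. Knuth moves, with $x<y<z$: a $K_1$ move exchanges a consecutive pattern $yxz$ with $yzx$; it is denoted $K_1^+$ when it replaces $yxz$ by $yzx$ (an "$xz$" pattern by a "$zx$" pattern) and $K_1^-$ when it replaces $yzx$ by $yxz$. A $K_B$ move exchanges consecutive $y_1xzy_2$ and $y_1zxy_2$ where $x<y_1<z$ and $x<y_2<z$. -}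

module Defs where

open import Data.Nat using (ℕ; zero; suc; _<_; _≥_; _>_)
open import Data.List using (List; []; _∷_; _++_; concat; reverse; map; upTo; length)
open import Data.List.Relation.Unary.All using (All)
open import Data.List.Relation.Unary.Linked using (Linked)
open import Data.List.Relation.Binary.Permutation.Propositional using (_↭_)
open import Data.Maybe using (Maybe; just; nothing)
open import Data.Product using (Σ; ∃; ∃₂; _×_; _,_)
open import Data.Sum using (_⊎_)
open import Relation.Binary.PropositionalEquality using (_≡_)

Word : Set
Word = List ℕ

-- A tableau (English notation) as its list of rows, top row first.
Tableau : Set
Tableau = List (List ℕ)

at : List ℕ → ℕ → Maybe ℕ
at []       _       = nothing
at (a ∷ as) zero    = just a
at (a ∷ as) (suc j) = at as j

NonEmpty : List ℕ → Set
NonEmpty xs = ∃₂ λ a as → xs ≡ a ∷ as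

ColumnStrict : List ℕ → List ℕ → Set
ColumnStrict R1 R2 = ∀ j b → at R2 j ≡ just b → ∃ λ a → at R1 j ≡ just a × a < b

record StandardTableau (n : ℕ) (P : Tableau) : Set where
  field
    rowsNonEmpty   : All NonEmpty P
    shapePartition : Linked _≥_ (map length P)
    rowsIncreasing : All (Linked _<_) P
    colsIncreasing : Linked ColumnStrict P
    entries        : concat P ↭ map suc (upTo n)

rowWord : Tableau → Word
rowWord P = concat (reverse P)

data K1plus : Word → Word → Set where
  k1plus : ∀ pre post x y z → x < y → y < z →
           K1plus (pre ++ y ∷ x ∷ z ∷ post) (pre ++ y ∷ z ∷ x ∷ post)

data K1minus : Word → Word → Set where
  k1minus : ∀ pre post x y z → x < y → y < z →
            K1minus (pre ++ y ∷ z ∷ x ∷ post) (pre ++ y ∷ x ∷ z ∷ post)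

data KB : Word → Word → Set where
  kbxz : ∀ pre post x y₁ z y₂ → x < y₁ → y₁ < z → x < y₂ → y₂ < z →
         KB (pre ++ y₁ ∷ x ∷ z ∷ y₂ ∷ post) (pre ++ y₁ ∷ z ∷ x ∷ y₂ ∷ post)
  kbzx : ∀ pre post x y₁ z y₂ → x < y₁ → y₁ < z → x < y₂ → y₂ < z →
         KB (pre ++ y₁ ∷ z ∷ x ∷ y₂ ∷ post) (pre ++ y₁ ∷ x ∷ z ∷ y₂ ∷ post)

singleton : ℕ → List ℕ
singleton a = a ∷ []

{-# OPTIONS --safe #-}
-- In the row reading word of a standard tableau an ascent never crosses a row
-- boundary (the first entry of a row is smaller than every entry of the row below
-- it), while a descent always does.  Hence in a factor y z x with x < y < z the
-- pair y z ends a row and x starts the next one; the second entry e of that row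
-- lies above an entry ≤ z, so x < e < z and the K₁⁻ move is a K_B move.
-- In a factor y x z the row of x starts with x z and y ends the row below; column
-- strictness forces y to be alone in its row, and then the shape forces every
-- lower row to be a single cell.  Finally the letter w after an ascent x z
-- satisfies z < w or w < x, so no K_B move on a reading word replaces an ascent
-- by a descent, whereas a K₁⁺ move always does.
module Submission where

open import Defs
open import Data.Nat using (ℕ; zero; suc; _<_; _>_; _≤_; _≥_; _+_; s≤s; z≤n)
open import Data.Nat.Properties using (<-asym; <-trans; <⇒≢; <⇒≤; ≤-refl; <-≤-trans; m≤n+m)
open import Data.List using (List; []; _∷_; _++_; _∷ʳ_; _ʳ++_; reverse; map; head; concat; length)
open import Data.List.Properties
  using (∷-injective; ∷-injectiveˡ; ∷-injectiveʳ; ++-assoc; ++-cancelˡ; ++-identityʳ; ∷ʳ-++; ++-ʳ++; ʳ++-defn;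
         reverse-involutive; reverse-map; map-++; concat-map-[_])
open import Data.List.Relation.Unary.All as All using (All; []; _∷_)
open import Data.List.Relation.Unary.All.Properties using (++⁻ʳ)
open import Data.List.Relation.Unary.Linked as Linked using (Linked; []; [-]; _∷_)
open import Data.Maybe using (just)
open import Data.Product using (∃₂; ∃-syntax; _×_; _,_)
open import Data.Sum as Sum using (_⊎_; inj₁; inj₂)
open import Data.Empty using (⊥-elim)
open import Function using (flip)
open import Relation.Nullary using (¬_)
open import Relation.Binary.PropositionalEquality
  using (_≡_; _≢_; refl; sym; trans; cong; subst)

++-∷-split : ∀ {A : Set} (xs : List A) {ys pre post a} → xs ++ ys ≡ pre ++ a ∷ post →
  (∃[ mid ] xs ≡ pre ++ a ∷ mid × post ≡ mid ++ ys)
  ⊎ (∃[ left ] ys ≡ left ++ a ∷ post × pre ≡ xs ++ left)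
++-∷-split []       {pre = pre}    eq = inj₂ (pre , eq , refl)
++-∷-split (x ∷ xs) {pre = []}     eq with refl , eq′ ← ∷-injective eq = inj₁ (xs , refl , sym eq′)
++-∷-split (x ∷ xs) {pre = _ ∷ _} eq with refl , eq′ ← ∷-injective eq with ++-∷-split xs eq′
... | inj₁ (mid , e₁ , e₂)  = inj₁ (mid , cong (x ∷_) e₁ , e₂)
... | inj₂ (left , e₁ , e₂) = inj₂ (left , e₁ , cong (x ∷_) e₂)

swap-aligned : ∀ {A : Set} (p q : List A) {u v u′ v′ s s′} → u ≢ v →
  p ++ u ∷ v ∷ s ≡ q ++ u′ ∷ v′ ∷ s′ → p ++ v ∷ u ∷ s ≡ q ++ v′ ∷ u′ ∷ s′ → u ≡ u′ × v ≡ v′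
swap-aligned []      []      _   e₁ _  = ∷-injectiveˡ e₁ , ∷-injectiveˡ (∷-injectiveʳ e₁)
swap-aligned []      (_ ∷ _) u≢v e₁ e₂ = ⊥-elim (u≢v (trans (∷-injectiveˡ e₁) (sym (∷-injectiveˡ e₂))))
swap-aligned (c ∷ p) []      u≢v e₁ e₂ with refl , t₁ ← ∷-injective e₁ | refl , t₂ ← ∷-injective e₂ =
  ⊥-elim (u≢v (∷-injectiveˡ (++-cancelˡ p _ _ (trans t₁ (sym t₂)))))
swap-aligned (_ ∷ p) (_ ∷ q) u≢v e₁ e₂ = swap-aligned p q u≢v (∷-injectiveʳ e₁) (∷-injectiveʳ e₂)

reverse-≡-++-∷-∷ : ∀ {A : Set} (xs : List A) {ys u v zs} → reverse xs ≡ ys ++ u ∷ v ∷ zs →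
  xs ≡ reverse zs ++ v ∷ u ∷ reverse ys
reverse-≡-++-∷-∷ xs {ys} {zs = zs} e =
  trans (sym (reverse-involutive xs)) (trans (cong reverse e) (trans (++-ʳ++ ys) (ʳ++-defn zs)))

shift-into-prefix : ∀ {A : Set} {xs : List A} ys {y zs} → xs ≡ ys ++ y ∷ zs → xs ≡ ys ∷ʳ y ++ zs
shift-into-prefix ys e = trans e (sym (∷ʳ-++ ys _ _))

concat-map-singleton : ∀ (xs : List ℕ) → concat (map singleton xs) ≡ xs
concat-map-singleton = concat-map-[_]

reverse-≡-map-singleton : ∀ (rows : Tableau) {xs} → reverse rows ≡ map singleton xs →
  rows ≡ map singleton (reverse xs)
reverse-≡-map-singleton rows {xs} e =
  trans (sym (reverse-involutive rows)) (trans (cong reverse e) (sym (reverse-map singleton xs)))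

at-++-length : ∀ (xs ys : List ℕ) i → at (xs ++ ys) (length xs + i) ≡ at ys i
at-++-length []       ys i = refl
at-++-length (_ ∷ xs) ys i = at-++-length xs ys i

all-reverse : ∀ {A : Set} {P : A → Set} {xs} → All P xs → All P (reverse xs)
all-reverse ps = all-ʳ++ _ ps []
  where
  all-ʳ++ : ∀ {A : Set} {P : A → Set} xs {acc} → All P xs → All P acc → All P (xs ʳ++ acc)
  all-ʳ++ []       []       qs = qs
  all-ʳ++ (_ ∷ xs) (p ∷ ps) qs = all-ʳ++ xs ps (p ∷ qs)

linked-++⁻ʳ : ∀ {A : Set} {R : A → A → Set} xs {ys} → Linked R (xs ++ ys) → Linked R ys
linked-++⁻ʳ []       l = l
linked-++⁻ʳ (_ ∷ xs) l = linked-++⁻ʳ xs (Linked.tail l)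

linked-ʳ++ : ∀ {A : Set} {R : A → A → Set} {x} xs {acc} →
  Linked R (x ∷ xs) → Linked (flip R) (x ∷ acc) → Linked (flip R) (xs ʳ++ x ∷ acc)
linked-ʳ++ []       _       l′ = l′
linked-ʳ++ (_ ∷ xs) (r ∷ l) l′ = linked-ʳ++ xs l (r ∷ l′)

linked-reverse : ∀ {A : Set} {R : A → A → Set} {xs} → Linked R xs → Linked (flip R) (reverse xs)
linked-reverse {xs = []}     _ = []
linked-reverse {xs = _ ∷ xs} l = linked-ʳ++ xs l [-]

increasing-at-≤ : ∀ {xs j k w} → Linked _<_ xs → at xs k ≡ just w → j ≤ k →
  ∃[ b ] at xs j ≡ just b × b ≤ w
increasing-at-≤ {[]}         _         ()
increasing-at-≤ {x ∷ _}      {zero} {zero}  _ refl _ = x , refl , ≤-refl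
increasing-at-≤ {x ∷ []}     {zero} {suc k} _ () _
increasing-at-≤ {x ∷ _ ∷ _}  {zero} {suc k} (x<y ∷ l) e _
  with _ , refl , y≤w ← increasing-at-≤ {j = zero} {k = k} l e z≤n = x , refl , <⇒≤ (<-≤-trans x<y y≤w)
increasing-at-≤ {_ ∷ _}      {suc j} {suc k} l e (s≤s j≤k) = increasing-at-≤ (Linked.tail l) e j≤k

-- The rows of a tableau listed from bottom to top, so that their concatenation
-- is the row reading word.
record BottomUp (L : Tableau) : Set where
  field
    rowsNonEmpty   : All NonEmpty L
    rowsIncreasing : All (Linked _<_) L
    colsIncreasing : Linked (flip ColumnStrict) L

bottomUp : ∀ {n P} → StandardTableau n P → BottomUp (reverse P)
bottomUp st = record
  { rowsNonEmpty   = all-reverse (rowsNonEmpty st)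
  ; rowsIncreasing = all-reverse (rowsIncreasing st)
  ; colsIncreasing = linked-reverse (colsIncreasing st)
  }
  where open StandardTableau

row-increasing : ∀ {L} below {row above} → BottomUp L → L ≡ below ++ row ∷ above → Linked _<_ row
row-increasing below T refl = All.head (++⁻ʳ below (BottomUp.rowsIncreasing T))

rows-above-nonempty : ∀ {L} below {row above} → BottomUp L → L ≡ below ++ row ∷ above → All NonEmpty above
rows-above-nonempty below T refl = All.tail (++⁻ʳ below (BottomUp.rowsNonEmpty T))

column-bound : ∀ {L} below {lower upper above j k w} → BottomUp L → L ≡ below ++ lower ∷ upper ∷ above →
  at lower k ≡ just w → j ≤ k → ∃[ a ] at upper j ≡ just a × a < w
column-bound below T refl e j≤k
  with b , eᵇ , b≤w ← increasing-at-≤ (All.head (++⁻ʳ below (BottomUp.rowsIncreasing T))) e j≤k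
  with a , eₐ , a<b ← Linked.head (linked-++⁻ʳ below (BottomUp.colsIncreasing T)) _ b eᵇ
  = a , eₐ , <-≤-trans a<b b≤w

concat-≡-∷ : ∀ {L : Tableau} {c s} → All NonEmpty L → concat L ≡ c ∷ s →
  ∃₂ λ row rest → L ≡ (c ∷ row) ∷ rest × s ≡ row ++ concat rest
concat-≡-∷ []                    ()
concat-≡-∷ ((_ , as , refl) ∷ _) refl = as , _ , refl , refl

-- An occurrence pre ++ factor ++ post of concat L whose letters fill the rows
-- block left right, left and right being the rest of the first and last of them.
record Occurrence (L : Tableau) (pre post : Word) (block : Word → Word → Tableau) : Set where
  field
    below above : Tableau
    left right  : Word
    rows   : L ≡ below ++ block left right ++ above
    before : pre ≡ concat below ++ left
    after  : post ≡ right ++ concat above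

SameRow : ℕ → ℕ → Word → Word → Tableau
SameRow a b left right = (left ++ a ∷ b ∷ right) ∷ []

RowBreak : ℕ → ℕ → Word → Word → Tableau
RowBreak a b left right = (left ++ a ∷ []) ∷ (b ∷ right) ∷ []

AscentRowBreak : ℕ → ℕ → ℕ → Word → Word → Tableau
AscentRowBreak a b c left right = (left ++ a ∷ b ∷ []) ∷ (c ∷ right) ∷ []

occurrence-∷ : ∀ {L R pre post block} → Occurrence L pre post block → Occurrence (R ∷ L) (R ++ pre) post block
occurrence-∷ {R = R} o = record
  { below = R ∷ below ; above = above ; left = left ; right = right
  ; rows = cong (R ∷_) rows
  ; before = trans (cong (R ++_) before) (sym (++-assoc R (concat below) left))
  ; after = after
  }
  where open Occurrence o

adjacent-occurrence : ∀ L {pre post a b} → All NonEmpty L → concat L ≡ pre ++ a ∷ b ∷ post →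
  Occurrence L pre post (SameRow a b) ⊎ Occurrence L pre post (RowBreak a b)
adjacent-occurrence []      {[]}    _        ()
adjacent-occurrence []      {_ ∷ _} _        ()
adjacent-occurrence (R ∷ L) (_ ∷ ne) eq with ++-∷-split R eq
... | inj₂ (left , eq′ , refl) = Sum.map occurrence-∷ occurrence-∷ (adjacent-occurrence L ne eq′)
... | inj₁ (_ ∷ mid , refl , e) with refl , refl ← ∷-injective e =
  inj₁ (record { below = [] ; above = L ; left = _ ; right = mid ; rows = refl ; before = refl ; after = refl })
... | inj₁ ([] , refl , e) with right , above , refl , refl ← concat-≡-∷ ne (sym e) =
  inj₂ (record { below = [] ; above = above ; left = _ ; right = right ; rows = refl ; before = refl ; after = refl })

ascent-in-row : ∀ {L pre post a b} → BottomUp L → concat L ≡ pre ++ a ∷ b ∷ post → a < b →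
  Occurrence L pre post (SameRow a b)
ascent-in-row {L} T eq a<b with adjacent-occurrence L (BottomUp.rowsNonEmpty T) eq
... | inj₁ o = o
... | inj₂ record { below = below ; left = left ; rows = rows }
  with _ , refl , b<a ← column-bound below T rows (at-++-length left _ 0) z≤n = ⊥-elim (<-asym a<b b<a)

descent-across-rows : ∀ {L pre post a b} → BottomUp L → concat L ≡ pre ++ a ∷ b ∷ post → b < a →
  Occurrence L pre post (RowBreak a b)
descent-across-rows {L} T eq b<a with adjacent-occurrence L (BottomUp.rowsNonEmpty T) eq
... | inj₂ o = o
... | inj₁ record { below = below ; left = left ; rows = rows } =
  ⊥-elim (<-asym b<a (Linked.head (linked-++⁻ʳ left (row-increasing below T rows))))

ascent-extends-or-breaks : ∀ {L pre post a b c} → BottomUp L → concat L ≡ pre ++ a ∷ b ∷ c ∷ post → a < b →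
  b < c ⊎ Occurrence L pre post (AscentRowBreak a b c)
ascent-extends-or-breaks T eq a<b with ascent-in-row T eq a<b
... | record { below = below ; left = left ; right = _ ∷ _ ; rows = rows ; after = after }
  with refl ← ∷-injectiveˡ after =
  inj₁ (Linked.head (Linked.tail (linked-++⁻ʳ left (row-increasing below T rows))))
... | record { below = below ; left = left ; right = [] ; rows = rows ; before = before ; after = after }
  with upper , above , refl , refl ← concat-≡-∷ (rows-above-nonempty below T rows) (sym after) =
  inj₂ (record { below = below ; above = above ; left = left ; right = upper
               ; rows = rows ; before = before ; after = refl })

ascent-successor : ∀ {L pre post x z w} → BottomUp L → concat L ≡ pre ++ x ∷ z ∷ w ∷ post → x < z →
  z < w ⊎ w < x
ascent-successor T eq x<z with ascent-extends-or-breaks T eq x<z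
... | inj₁ z<w = inj₁ z<w
... | inj₂ record { below = below ; left = left ; rows = rows }
  with _ , refl , w<x ← column-bound below T rows (at-++-length left _ 0) z≤n = inj₂ w<x

peak-successor-between : ∀ {L pre post x y z} → BottomUp L → concat L ≡ pre ++ y ∷ z ∷ x ∷ post →
  x < y → y < z → ∃₂ λ e post′ → post ≡ e ∷ post′ × x < e × e < z
peak-successor-between T eq x<y y<z with ascent-extends-or-breaks T eq y<z
... | inj₁ z<x = ⊥-elim (<-asym (<-trans x<y y<z) z<x)
... | inj₂ record { below = below ; left = left ; right = [] ; rows = rows }
  with _ , () , _ ← column-bound below T rows (at-++-length left _ 1) (m≤n+m 1 (length left))
... | inj₂ record { below = below ; left = left ; right = e ∷ _ ; rows = rows ; after = after }
  with _ , refl , e<z ← column-bound below T rows (at-++-length left _ 1) (m≤n+m 1 (length left)) =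
  e , _ , after , Linked.head (row-increasing (below ∷ʳ _) T (shift-into-prefix below rows)) , e<z

k1minus-is-KB : ∀ {L w r} → BottomUp L → concat L ≡ w → K1minus w r → KB w r
k1minus-is-KB T eq (k1minus pre post x y z x<y y<z)
  with e , post′ , refl , x<e , e<z ← peak-successor-between T eq x<y y<z =
  kbzx pre post′ x y z e x<y y<z x<e e<z

KB-swaps-descent : ∀ {L w r} → BottomUp L → concat L ≡ w → KB w r →
  ∃₂ λ p s → ∃₂ λ u v → v < u × w ≡ p ++ u ∷ v ∷ s × r ≡ p ++ v ∷ u ∷ s
KB-swaps-descent T eq (kbxz pre post x y₁ z y₂ _ _ x<y₂ y₂<z) =
  ⊥-elim (Sum.[ <-asym y₂<z , <-asym x<y₂ ]
    (ascent-successor T (shift-into-prefix pre eq) (<-trans x<y₂ y₂<z)))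
KB-swaps-descent T eq (kbzx pre post x y₁ z y₂ x<y₁ y₁<z _ _) =
  pre ∷ʳ y₁ , y₂ ∷ post , z , x , <-trans x<y₁ y₁<z , shift-into-prefix pre refl , shift-into-prefix pre refl

k1plus-is-not-KB : ∀ {L w r} → BottomUp L → concat L ≡ w → K1plus w r → ¬ KB w r
k1plus-is-not-KB T eq (k1plus pre post x y z x<y y<z) kb
  with p , s , u , v , v<u , e₁ , e₂ ← KB-swaps-descent T eq kb
  with refl , refl ← swap-aligned (pre ∷ʳ y) p (<⇒≢ (<-trans x<y y<z))
                       (trans (∷ʳ-++ pre y _) e₁) (trans (∷ʳ-++ pre y _) e₂) =
  <-asym (<-trans x<y y<z) v<u

descent-ascent-rows : ∀ {L pre post x y z} → BottomUp L → concat L ≡ pre ++ y ∷ x ∷ z ∷ post →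
  x < y → y < z →
  ∃₂ λ below above → ∃[ right ] L ≡ below ++ (y ∷ []) ∷ (x ∷ z ∷ right) ∷ above × pre ≡ concat below
descent-ascent-rows T eq x<y y<z with descent-across-rows T eq x<y
... | record { below = below ; left = left ; right = [] ; rows = rows ; after = after }
  with _ , _ , refl , _ ← concat-≡-∷ (rows-above-nonempty (below ∷ʳ _) T (shift-into-prefix below rows)) (sym after)
  with _ , refl , z<x ← column-bound (below ∷ʳ _) {k = 0} T (shift-into-prefix below rows) refl z≤n =
  ⊥-elim (<-asym (<-trans x<y y<z) z<x)
... | record { below = below ; left = r ∷ left ; right = _ ∷ _ ; rows = rows ; after = after }
  with refl ← ∷-injectiveˡ after
  with _ , refl , z<y ← column-bound below T rows (at-++-length (r ∷ left) _ 0) (s≤s z≤n) =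
  ⊥-elim (<-asym y<z z<y)
... | record { below = below ; above = above ; left = [] ; right = _ ∷ right
             ; rows = rows ; before = before ; after = after }
  with refl ← ∷-injectiveˡ after =
  below , above , right , rows , trans before (++-identityʳ _)

singleton-rows-under : ∀ {c} S → All NonEmpty S → Linked ColumnStrict ((c ∷ []) ∷ S) →
  Linked _≥_ (map length ((c ∷ []) ∷ S)) → ∃[ V ] S ≡ map singleton V × Linked _<_ (c ∷ V)
singleton-rows-under []                _                  _          _             = [] , refl , [-]
singleton-rows-under ([] ∷ _)          ((_ , _ , ()) ∷ _) _          _
singleton-rows-under ((_ ∷ _ ∷ _) ∷ _) _                  _          (s≤s () ∷ _)
singleton-rows-under ((a ∷ []) ∷ S)    (_ ∷ ne)           (cs ∷ css) (_ ∷ lens)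
  with _ , refl , c<a ← cs 0 a refl
  with V , refl , a<V ← singleton-rows-under S ne css lens = a ∷ V , refl , c<a ∷ a<V

suffix-rows : ∀ {n P} Q {S} → StandardTableau n P → P ≡ Q ++ S →
  All NonEmpty S × Linked ColumnStrict S × Linked _≥_ (map length S)
suffix-rows Q st refl =
    ++⁻ʳ Q (rowsNonEmpty st)
  , linked-++⁻ʳ Q (colsIncreasing st)
  , linked-++⁻ʳ (map length Q) (subst (Linked _≥_) (map-++ length Q _) (shapePartition st))
  where open StandardTableau

descent-ascent-shape : ∀ {n P pre post x y z} → StandardTableau n P →
  rowWord P ≡ pre ++ y ∷ x ∷ z ∷ post → x < y → y < z →
  Linked _>_ (pre ++ y ∷ x ∷ [])
  × ∃₂ λ Q rest → P ≡ Q ++ (x ∷ z ∷ rest) ∷ (y ∷ []) ∷ map singleton (reverse pre)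
descent-ascent-shape {P = P} {x = x} {y} {z} st eq x<y y<z
  with below , above , right , rowsL , refl ← descent-ascent-rows (bottomUp st) eq x<y y<z
  with rowsP ← reverse-≡-++-∷-∷ P rowsL
  with ne , cols , lens ← suffix-rows (reverse above ∷ʳ (x ∷ z ∷ right)) st (shift-into-prefix (reverse above) rowsP)
  with V , lower-rows , y<V ← singleton-rows-under (reverse below) (All.tail ne) cols lens
  with refl ← reverse-≡-map-singleton below lower-rows
  rewrite concat-map-singleton (reverse V) | reverse-involutive V =
    subst (Linked _>_) (ʳ++-defn V) (linked-ʳ++ V y<V (x<y ∷ [-]))
  , reverse above , right
  , trans rowsP (cong (λ S → reverse above ++ (x ∷ z ∷ right) ∷ (y ∷ []) ∷ S) lower-rows)

lemma7p6 : ∀ (n : ℕ) (P : Tableau) → StandardTableau n P →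
    (∀ r' → K1minus (rowWord P) r' → KB (rowWord P) r')
    × (∀ (pre post : List ℕ) (x y z : ℕ) → x < y → y < z →
         rowWord P ≡ pre ++ y ∷ x ∷ z ∷ post →
         ¬ (head (rowWord P) ≡ just y) →
         Linked _>_ (pre ++ y ∷ x ∷ [])
         × ∃₂ (λ (Q : Tableau) (rest : List ℕ) →
              P ≡ Q ++ (x ∷ z ∷ rest) ∷ (y ∷ []) ∷ map singleton (reverse pre)))
    × (∀ r' → K1plus (rowWord P) r' → ¬ KB (rowWord P) r')
lemma7p6 n P st =
    (λ _ → k1minus-is-KB T refl)
  , (λ _ _ _ _ _ x<y y<z eq _ → descent-ascent-shape st eq x<y y<z)
  , (λ _ → k1plus-is-not-KB T refl)
  where
  T : BottomUp (reverse P)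
  T = bottomUp st
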